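{- Let $\mathbf A=(A,\wedge,\vee,\neg,0,1)$ be a bounded involutive lattice with Sasaki product $xy:=x\wedge(\neg x\vee y)$. Then: (1) $\cdot$ is power associative and alternative; (2) $(xy)x=xy$ for all $x,y\in A$; (3) $x(yx)\le (xy)x$ for all $x,y\in A$; (4) if $\mathbf A$ also satisfies $x(y\vee z)\approx xy\vee xz$, then $\cdot$ is flexible. In particular, this holds if $\mathbf A$ is (the lattice reduct of) a residuated ortholattice.
   Context: A bounded involutive lattice is a bounded lattice with an order-reversing involution $\neg$. A binary operation $\star$ on $A$ is left alternative if $(x\star x)\star y=x\star(x\star y)$ for all $x,y$; right alternative if $y\star(x\star x)=(y\star x)\star x$ for all $x,y$; alternative if both; flexible if $(x\star y)\star x=x\star(y\star x)$ for all $x,y$; power associative if $\star$ is associative in every 1-generated subalgebra of $(A,\star)$. A residuated ortholattice is a bounded involutive lattice expanded by a binary operation $\backslash$ with $x\cdot y\le z\iff y\le x\backslash z$ for all $x,y,z$. -}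

module Defs where

open import Level using (Level; suc; _⊔_)
open import Data.Product using (_×_)
open import Algebra.Lattice.Bundles using (Lattice)

record BoundedInvolutiveLattice (c ℓ : Level) : Set (suc (c ⊔ ℓ)) where
  field
    lattice : Lattice c ℓ
  open Lattice lattice public

  infix 4 _≤_
  _≤_ : Carrier → Carrier → Set ℓ
  x ≤ y = (x ∧ y) ≈ x

  field
    ⊤ ⊥ : Carrier
    ¬ : Carrier → Carrier
    ¬-cong : ∀ {x y} → x ≈ y → ¬ x ≈ ¬ y
    ⊥-least : ∀ x → ⊥ ≤ x
    ⊤-greatest : ∀ x → x ≤ ⊤
    ¬-involutive : ∀ x → ¬ (¬ x) ≈ x
    ¬-antitone : ∀ {x y} → x ≤ y → ¬ y ≤ ¬ x

  infixl 7 _·_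
  _·_ : Carrier → Carrier → Carrier
  x · y = x ∧ (¬ x ∨ y)

-- Terms in one variable over a binary operation: the elements of the
-- subalgebra of (A, ⋆) generated by x are exactly the values of such terms.
data Term : Set where
  var : Term
  _⊛_ : Term → Term → Term

module _ {a ℓ : Level} {A : Set a} (_≈_ : A → A → Set ℓ) (_⋆_ : A → A → A) where

  eval : A → Term → A
  eval x var = x
  eval x (s ⊛ t) = eval x s ⋆ eval x t

  LeftAlternative : Set (a ⊔ ℓ)
  LeftAlternative = ∀ x y → ((x ⋆ x) ⋆ y) ≈ (x ⋆ (x ⋆ y))

  RightAlternative : Set (a ⊔ ℓ)
  RightAlternative = ∀ x y → (y ⋆ (x ⋆ x)) ≈ ((y ⋆ x) ⋆ x)

  Alternative : Set (a ⊔ ℓ)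
  Alternative = LeftAlternative × RightAlternative

  Flexible : Set (a ⊔ ℓ)
  Flexible = ∀ x y → ((x ⋆ y) ⋆ x) ≈ (x ⋆ (y ⋆ x))

  PowerAssociative : Set (a ⊔ ℓ)
  PowerAssociative = ∀ x (s t u : Term) →
    eval x (s ⊛ (t ⊛ u)) ≈ eval x ((s ⊛ t) ⊛ u)

-- Everything rests on one absorption law: a · b ≈ a as soon as a ≤ ¬ a ∨ b.
-- It makes · idempotent, so every 1-generated subalgebra is a singleton, and
-- it yields (x · y) · x ≈ x · y and (y · x) · x ≈ y · x.  Monotonicity of x · _
-- gives x · (y · x) ≤ x · y.  For the converse under left distributivity,
-- enlarge x to w = x ∨ ¬ y: then x · y ≤ w · (¬ x ∨ y) = w · ¬ x ∨ w · y,
-- where w · ¬ x ≤ ¬ x and w · y ≤ y · x because ¬ w ≤ ¬ x and ¬ w ≤ y.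
-- A residuated x · _ is a left adjoint, hence distributes over joins.
module Submission where

open import Defs
open import Level using (Level)
open import Data.Product using (_×_; _,_; proj₁; proj₂)
import Algebra.Definitions as AlgebraDefinitions
import Algebra.Lattice.Properties.Lattice as LatticeProperties
import Relation.Binary.Lattice as OrderTheoretic
import Relation.Binary.Lattice.Properties.JoinSemilattice as JoinSemilatticeProperties
import Relation.Binary.Lattice.Properties.MeetSemilattice as MeetSemilatticeProperties
import Relation.Binary.Reasoning.PartialOrder as PartialOrderReasoning

module SasakiProduct {c ℓ : Level} (A : BoundedInvolutiveLattice c ℓ) where
  open BoundedInvolutiveLattice A
  open AlgebraDefinitions _≈_ using (_DistributesOverˡ_)

  private
    L : OrderTheoretic.Lattice c ℓ ℓ
    L = LatticeProperties.∨-∧-orderTheoreticLattice lattice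

  -- Here  x ⊑ y  means  x ≈ x ∧ y,  whereas  x ≤ y  means  x ∧ y ≈ x.
  open OrderTheoretic.Lattice L
    using (x∧y≤x; x∧y≤y; ∧-greatest; x≤x∨y; y≤x∨y; ∨-least; antisym; poset)
    renaming (_≤_ to _⊑_; refl to ⊑-refl; reflexive to ⊑-reflexive; trans to ⊑-trans)
  open JoinSemilatticeProperties (OrderTheoretic.Lattice.joinSemilattice L)
    using (∨-monotonic)
  open MeetSemilatticeProperties (OrderTheoretic.Lattice.meetSemilattice L)
    using (∧-monotonic)
  open PartialOrderReasoning poset

  ≤⇒⊑ : ∀ {x y} → x ≤ y → x ⊑ y
  ≤⇒⊑ = sym

  ⊑⇒≤ : ∀ {x y} → x ⊑ y → x ≤ y
  ⊑⇒≤ = sym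

  ¬-antitoneᵒ : ∀ {x y} → x ⊑ y → ¬ y ⊑ ¬ x
  ¬-antitoneᵒ x⊑y = ≤⇒⊑ (¬-antitone (⊑⇒≤ x⊑y))

  ¬-flipˡ : ∀ {x y} → ¬ x ⊑ y → ¬ y ⊑ x
  ¬-flipˡ {x} ¬x⊑y = ⊑-trans (¬-antitoneᵒ ¬x⊑y) (⊑-reflexive (¬-involutive x))

  ·-cong : ∀ {x x′ y y′} → x ≈ x′ → y ≈ y′ → x · y ≈ x′ · y′
  ·-cong x≈x′ y≈y′ = ∧-cong x≈x′ (∨-cong (¬-cong x≈x′) y≈y′)

  ·-monoʳ : ∀ {x y z} → y ⊑ z → x · y ⊑ x · z
  ·-monoʳ y⊑z = ∧-monotonic ⊑-refl (∨-monotonic ⊑-refl y⊑z)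

  x·y⊑x : ∀ x y → x · y ⊑ x
  x·y⊑x x y = x∧y≤x x (¬ x ∨ y)

  x·y⊑¬x∨y : ∀ x y → x · y ⊑ ¬ x ∨ y
  x·y⊑¬x∨y x y = x∧y≤y x (¬ x ∨ y)

  ·-absorbs : ∀ {a b} → a ⊑ ¬ a ∨ b → a · b ≈ a
  ·-absorbs a⊑¬a∨b = antisym (x∧y≤x _ _) (∧-greatest ⊑-refl a⊑¬a∨b)

  ·-idem : ∀ x → x · x ≈ x
  ·-idem x = ·-absorbs (y≤x∨y (¬ x) x)

  eval≈generator : ∀ x t → eval _≈_ _·_ x t ≈ x
  eval≈generator x var = refl
  eval≈generator x (s ⊛ t) =
    trans (·-cong (eval≈generator x s) (eval≈generator x t)) (·-idem x)

  ·-powerAssociative : PowerAssociative _≈_ _·_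
  ·-powerAssociative x s t u =
    trans (eval≈generator x (s ⊛ (t ⊛ u))) (sym (eval≈generator x ((s ⊛ t) ⊛ u)))

  x·[x·y]≈x·y : ∀ x y → x · (x · y) ≈ x · y
  x·[x·y]≈x·y x y = antisym
    (∧-greatest (x∧y≤x _ _)
      (⊑-trans (x∧y≤y _ _) (∨-least (x≤x∨y (¬ x) y) (x·y⊑¬x∨y x y))))
    (∧-greatest (x·y⊑x x y) (y≤x∨y (¬ x) (x · y)))

  [x·y]·x≈x·y : ∀ x y → (x · y) · x ≈ x · y
  [x·y]·x≈x·y x y = ·-absorbs (⊑-trans (x·y⊑x x y) (y≤x∨y _ x))

  [y·x]·x≈y·x : ∀ x y → (y · x) · x ≈ y · x
  [y·x]·x≈y·x x y = ·-absorbs (begin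
    y · x            ≤⟨ x·y⊑¬x∨y y x ⟩
    ¬ y ∨ x          ≤⟨ ∨-monotonic (¬-antitoneᵒ (x·y⊑x y x)) ⊑-refl ⟩
    ¬ (y · x) ∨ x    ∎)

  ·-leftAlternative : LeftAlternative _≈_ _·_
  ·-leftAlternative x y = trans (·-cong (·-idem x) refl) (sym (x·[x·y]≈x·y x y))

  ·-rightAlternative : RightAlternative _≈_ _·_
  ·-rightAlternative x y = trans (·-cong refl (·-idem x)) (sym ([y·x]·x≈y·x x y))

  x·[y·x]⊑x·y : ∀ x y → x · (y · x) ⊑ x · y
  x·[y·x]⊑x·y x y = ·-monoʳ (x·y⊑x y x)

  x·[y·x]≤[x·y]·x : ∀ x y → x · (y · x) ≤ (x · y) · x
  x·[y·x]≤[x·y]·x x y =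
    ⊑⇒≤ (⊑-trans (x·[y·x]⊑x·y x y) (⊑-reflexive (sym ([x·y]·x≈x·y x y))))

  x·y⊑x·[y·x] : _·_ DistributesOverˡ _∨_ → ∀ x y → x · y ⊑ x · (y · x)
  x·y⊑x·[y·x] distrib x y =
    ∧-greatest (x·y⊑x x y) (begin
      x · y                 ≤⟨ ∧-monotonic (x≤x∨y x (¬ y)) (y≤x∨y (¬ w) (¬ x ∨ y)) ⟩
      w · (¬ x ∨ y)         ≈⟨ distrib w (¬ x) y ⟩
      w · ¬ x ∨ w · y       ≤⟨ ∨-monotonic w·¬x⊑¬x w·y⊑y·x ⟩
      ¬ x ∨ y · x           ∎)
    where
    w = x ∨ ¬ y
    ¬w⊑¬x : ¬ w ⊑ ¬ x
    ¬w⊑¬x = ¬-antitoneᵒ (x≤x∨y x (¬ y))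
    w·¬x⊑¬x : w · ¬ x ⊑ ¬ x
    w·¬x⊑¬x = ⊑-trans (x·y⊑¬x∨y w (¬ x)) (∨-least ¬w⊑¬x ⊑-refl)
    w·y⊑y·x : w · y ⊑ y · x
    w·y⊑y·x = begin
      w · y       ≤⟨ ∧-monotonic ⊑-refl (∨-least (¬-flipˡ (y≤x∨y x (¬ y))) ⊑-refl) ⟩
      w ∧ y       ≈⟨ ∧-comm w y ⟩
      y ∧ w       ≤⟨ ∧-monotonic ⊑-refl (∨-least (y≤x∨y (¬ y) x) (x≤x∨y (¬ y) x)) ⟩
      y · x       ∎

  ·-flexible : _·_ DistributesOverˡ _∨_ → Flexible _≈_ _·_
  ·-flexible distrib x y =
    trans ([x·y]·x≈x·y x y) (antisym (x·y⊑x·[y·x] distrib x y) (x·[y·x]⊑x·y x y))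

  leftAdjoint-preserves-∨ : (f g : Carrier → Carrier) →
    (∀ y z → f y ⊑ z → y ⊑ g z) → (∀ y z → y ⊑ g z → f y ⊑ z) →
    ∀ y z → f (y ∨ z) ≈ f y ∨ f z
  leftAdjoint-preserves-∨ f g transpose untranspose y z = antisym
    (untranspose (y ∨ z) (f y ∨ f z)
      (∨-least (transpose y _ (x≤x∨y (f y) (f z)))
               (transpose z _ (y≤x∨y (f y) (f z)))))
    (∨-least (monotone (x≤x∨y y z)) (monotone (y≤x∨y y z)))
    where
    monotone : ∀ {u v} → u ⊑ v → f u ⊑ f v
    monotone {u} {v} u⊑v = untranspose u (f v) (⊑-trans u⊑v (transpose v (f v) ⊑-refl))

  residuated⇒·-distribˡ-∨ : (_⟍_ : Carrier → Carrier → Carrier) →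
    (∀ x y z → ((x · y ≤ z → y ≤ x ⟍ z) × (y ≤ x ⟍ z → x · y ≤ z))) →
    _·_ DistributesOverˡ _∨_
  residuated⇒·-distribˡ-∨ _⟍_ residuated x =
    leftAdjoint-preserves-∨ (x ·_) (x ⟍_)
      (λ y z xy⊑z → ≤⇒⊑ (proj₁ (residuated x y z) (⊑⇒≤ xy⊑z)))
      (λ y z y⊑x⟍z → ≤⇒⊑ (proj₂ (residuated x y z) (⊑⇒≤ y⊑x⟍z)))

lemma2p5 : ∀ {c ℓ : Level} (A : BoundedInvolutiveLattice c ℓ) →
    let open BoundedInvolutiveLattice A in
    (PowerAssociative _≈_ _·_ × Alternative _≈_ _·_)
    × (∀ x y → ((x · y) · x) ≈ (x · y))
    × (∀ x y → (x · (y · x)) ≤ ((x · y) · x))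
    × ((∀ x y z → (x · (y ∨ z)) ≈ ((x · y) ∨ (x · z))) → Flexible _≈_ _·_)
    × ((_⟍_ : Carrier → Carrier → Carrier) →
    (∀ x y z → (((x · y) ≤ z → y ≤ (x ⟍ z)) × (y ≤ (x ⟍ z) → (x · y) ≤ z))) →
    Flexible _≈_ _·_)
lemma2p5 A =
    (·-powerAssociative , ·-leftAlternative , ·-rightAlternative)
  , [x·y]·x≈x·y
  , x·[y·x]≤[x·y]·x
  , ·-flexible
  , (λ _⟍_ residuated → ·-flexible (residuated⇒·-distribˡ-∨ _⟍_ residuated))
  where
  open SasakiProduct A
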